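{- For every signed graph $(G,\sigma)$, $C_r(G,\sigma)=C_r(G,-\sigma)$.
   Context: A signed graph $(G,\sigma)$ is a finite simple graph $G$ with a map $\sigma\colon E(G)\to\{+,-\}$ ($\{\pm\}$ viewed as a multiplicative group); $-\sigma$ is the signature obtained by reversing every sign. Relaxed information dissemination (rID) process on $(G,\sigma)$: each vertex has a state in $\{A,-A,C,0\}$, initially all $0$. In step $i\geq 1$: choose a vertex $v_i$ of state $0$ (a placement vertex) and set its state to $A$ or to $-A$ (either choice allowed). Then, simultaneously for every vertex $v$ currently in state $0$, consider its neighbours $z$ currently in state $A$ or $-A$ (states after placing $v_i$, before this step's updates); each such $z$ sends $\sigma(vz)\cdot\mathrm{state}(z)$ (with $-(-A)=A$). If $v$ has no such neighbour it stays $0$; if all sent values are equal, $v$ takes that value; if two sent values differ, $v$ gets state $C$ (confused). Vertices with state $A$, $-A$ or $C$ keep their state. Repeat until no vertex has state $0$. The value of the run is the number of vertices of final state $C$. The relaxed confusion number $C_r(G,\sigma)$ is the minimum value over all possible runs. -}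

module Defs where

open import Data.Nat using (ℕ; zero; suc; _+_; _≤_)
open import Data.Fin using (Fin; _≟_)
open import Data.Bool using (Bool; true; false; if_then_else_; _∧_)
open import Data.List using (List; []; _∷_; allFin; map; foldr)
open import Data.Nat.ListAction using (sum)
open import Data.Product using (Σ; _×_)
open import Relation.Binary.PropositionalEquality using (_≡_; _≢_)
open import Relation.Nullary using (yes; no)

record Graph (n : ℕ) : Set where
  field
    adj   : Fin n → Fin n → Bool
    sym   : ∀ u v → adj u v ≡ adj v u
    irrefl : ∀ v → adj v v ≡ false
open Graph public

data Sign : Set where
  plus minus : Sign

negS : Sign → Sign
negS plus = minus
negS minus = plus

-- A signature on G: a sign for each edge (given on ordered pairs, required
-- symmetric on edges; values on non-edges are irrelevant).
record Signature {n : ℕ} (G : Graph n) : Set where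
  field
    sgn : Fin n → Fin n → Sign
    sgn-sym : ∀ u v → adj G u v ≡ true → sgn u v ≡ sgn v u
open Signature public

negSig : ∀ {n} {G : Graph n} → Signature G → Signature G
negSig {G = G} σ = record
  { sgn = λ u v → negS (sgn σ u v)
  ; sgn-sym = λ u v e → helper (sgn-sym σ u v e) }
  where
  helper : ∀ {a b} → a ≡ b → negS a ≡ negS b
  helper _≡_.refl = _≡_.refl

-- States: A, -A, C (confused), 0 (O)
data State : Set where
  A negA C O : State

_==_ : State → State → Bool
A == A = true
negA == negA = true
C == C = true
O == O = true
_ == _ = false

act : Sign → State → State
act plus s = s
act minus A = negA
act minus negA = A
act minus s = s

isInformed : State → Bool
isInformed A = true
isInformed negA = true
isInformed _ = false

isZero : State → Bool
isZero O = true
isZero _ = false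

isC : State → Bool
isC C = true
isC _ = false

Config : ℕ → Set
Config n = Fin n → State

placed : Sign → State
placed plus = A
placed minus = negA

setAt : ∀ {n} → Config n → Fin n → State → Config n
setAt s v a w with w ≟ v
... | yes _ = a
... | no _ = s w

received : ∀ {n} (G : Graph n) → Signature G → Config n → Fin n → List State
received {n} G σ s v = foldr f [] (allFin n)
  where
  f : Fin n → List State → List State
  f z acc = if adj G v z ∧ isInformed (s z) then act (sgn σ v z) (s z) ∷ acc else acc

allEq : State → List State → Bool
allEq x [] = true
allEq x (y ∷ ys) = (x == y) ∧ allEq x ys

resolve : List State → State
resolve [] = O
resolve (x ∷ xs) = if allEq x xs then x else C

update : ∀ {n} (G : Graph n) → Signature G → Config n → Config n
update G σ s v = if isZero (s v) then resolve (received G σ s v) else s v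

stepConfig : ∀ {n} (G : Graph n) → Signature G → Config n → Fin n → Sign → Config n
stepConfig G σ s v a = update G σ (setAt s v (placed a))

countC : ∀ {n} → Config n → ℕ
countC {n} s = sum (map (λ v → if isC (s v) then 1 else 0) (allFin n))

allZero : ∀ {n} → Config n
allZero _ = O

data Run {n : ℕ} (G : Graph n) (σ : Signature G) : Config n → ℕ → Set where
  done : ∀ {s} → (∀ v → s v ≢ O) → Run G σ s (countC s)
  step : ∀ {s k} (v : Fin n) → s v ≡ O → (a : Sign) →
         Run G σ (stepConfig G σ s v a) k → Run G σ s k

-- k is the relaxed confusion number: minimum value over all runs from all-0.
IsCr : ∀ {n} (G : Graph n) → Signature G → ℕ → Set
IsCr G σ k = Run G σ allZero k × (∀ {m} → Run G σ allZero m → k ≤ m)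

{-# OPTIONS --safe #-}
-- Replay a run on (G, σ) on (G, −σ), placing the same vertex in each step but with its sign
-- multiplied by a twist p that alternates between + and − from step to step.  A vertex still
-- in state 0 only hears from neighbours informed in the current step (placed now, or updated
-- at the end of the previous step), and all of these carry the current twist p.  Reversing
-- every edge sign then makes it receive −p times what it received before, so it is informed
-- with twist −p, the twist of the next step.  No sign moves C, so both runs end with the same
-- number of confused vertices, and by symmetry (G, σ) and (G, −σ) have the same run values.
-- Their minimum exists because each step strictly shrinks the set of vertices in state 0.
module Submission where

open import Defs hiding (sym)
open import Data.Bool using (Bool; true; false; if_then_else_; _∧_)
open import Data.Bool.Properties using (∧-conicalʳ)
open import Data.Empty using (⊥-elim)
open import Data.Fin using (Fin; zero; suc; _≟_)
open import Data.Fin.Properties using (any?)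
open import Data.Fin.Subset using (Subset; _∈_; _⊂_)
open import Data.Fin.Subset.Induction using (⊂-wellFounded)
open import Data.List using ([]; _∷_; allFin; map; foldr)
open import Data.List.Properties using (foldr-fusion; map-cong)
import Data.List.Membership.Propositional as List
open import Data.List.Membership.Propositional.Properties using (∈-allFin)
open import Data.List.Relation.Unary.Any using (here; there)
open import Data.Nat using (ℕ; _≤_)
open import Data.Nat.ListAction using (sum)
open import Data.Nat.Properties using (≤-refl; ≤-trans; ≤-total)
open import Data.Product using (Σ; _×_; _,_; ∃; ∃₂; proj₁; proj₂)
import Data.Product as Product
open import Data.Sum using (_⊎_; inj₁; inj₂; [_,_])
import Data.Sum as Sum
open import Data.Vec using (tabulate)
open import Data.Vec.Properties using (lookup∘tabulate; []=⇒lookup; lookup⇒[]=)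
open import Function using (_∘_; _on_)
open import Induction.WellFounded using (Acc; acc)
import Relation.Binary.Construct.On as On
open import Relation.Binary.PropositionalEquality
  using (_≡_; _≢_; refl; sym; trans; cong; subst; module ≡-Reasoning)
open import Relation.Nullary using (¬_; Dec; yes; no)

_·_ : Sign → Sign → Sign
plus  · g = g
minus · g = negS g

negS-involutive : ∀ g → negS (negS g) ≡ g
negS-involutive plus  = refl
negS-involutive minus = refl

negS-·-comm : ∀ g h → negS g · h ≡ negS h · g
negS-·-comm plus  plus  = refl
negS-·-comm plus  minus = refl
negS-·-comm minus plus  = refl
negS-·-comm minus minus = refl

act-· : ∀ g h w → act g (act h w) ≡ act (g · h) w
act-· plus  h     w    = refl
act-· minus plus  w    = refl
act-· minus minus A    = refl
act-· minus minus negA = refl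
act-· minus minus C    = refl
act-· minus minus O    = refl

act-negS-swap : ∀ g h w → act (negS g) (act h w) ≡ act (negS h) (act g w)
act-negS-swap g h w = begin
  act (negS g) (act h w)  ≡⟨ act-· (negS g) h w ⟩
  act (negS g · h) w      ≡⟨ cong (λ k → act k w) (negS-·-comm g h) ⟩
  act (negS h · g) w      ≡⟨ act-· (negS h) g w ⟨
  act (negS h) (act g w)  ∎
  where open ≡-Reasoning

act-O : ∀ g → act g O ≡ O
act-O plus  = refl
act-O minus = refl

act-C : ∀ g → act g C ≡ C
act-C plus  = refl
act-C minus = refl

act≡O⇒≡O : ∀ g {w} → act g w ≡ O → w ≡ O
act≡O⇒≡O plus  eq = eq
act≡O⇒≡O minus {A}    ()
act≡O⇒≡O minus {negA} ()
act≡O⇒≡O minus {C}    ()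
act≡O⇒≡O minus {O}    _ = refl

placed-· : ∀ g a → placed (g · a) ≡ act g (placed a)
placed-· plus  a     = refl
placed-· minus plus  = refl
placed-· minus minus = refl

isC-act : ∀ g w → isC (act g w) ≡ isC w
isC-act plus  w    = refl
isC-act minus A    = refl
isC-act minus negA = refl
isC-act minus C    = refl
isC-act minus O    = refl

isInformed-act : ∀ g w → isInformed (act g w) ≡ isInformed w
isInformed-act plus  w    = refl
isInformed-act minus A    = refl
isInformed-act minus negA = refl
isInformed-act minus C    = refl
isInformed-act minus O    = refl

==-act : ∀ g x y → (act g x == act g y) ≡ (x == y)
==-act plus  x    y    = refl
==-act minus A    A    = refl
==-act minus A    negA = refl
==-act minus A    C    = refl
==-act minus A    O    = refl
==-act minus negA A    = refl
==-act minus negA negA = refl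
==-act minus negA C    = refl
==-act minus negA O    = refl
==-act minus C    A    = refl
==-act minus C    negA = refl
==-act minus C    C    = refl
==-act minus C    O    = refl
==-act minus O    A    = refl
==-act minus O    negA = refl
==-act minus O    C    = refl
==-act minus O    O    = refl

allEq-act : ∀ g x ys → allEq (act g x) (map (act g) ys) ≡ allEq x ys
allEq-act g x []       = refl
allEq-act g x (y ∷ ys) rewrite ==-act g x y | allEq-act g x ys = refl

resolve-act : ∀ g ws → resolve (map (act g) ws) ≡ act g (resolve ws)
resolve-act g []       = sym (act-O g)
resolve-act g (w ∷ ws) rewrite allEq-act g w ws with allEq w ws
... | true  = refl
... | false = sym (act-C g)

resolve-∷-≢O : ∀ {w ws} → w ≢ O → resolve (w ∷ ws) ≢ O
resolve-∷-≢O {w} {ws} w≢O with allEq w ws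
... | true  = w≢O
... | false = λ ()

isO? : ∀ w → Dec (w ≡ O)
isO? A    = no λ ()
isO? negA = no λ ()
isO? C    = no λ ()
isO? O    = yes refl

isZero⇒≡O : ∀ {w} → isZero w ≡ true → w ≡ O
isZero⇒≡O {O} _ = refl

informed⇒≢O : ∀ {w} → isInformed w ≡ true → w ≢ O
informed⇒≢O {A}    _ ()
informed⇒≢O {negA} _ ()

¬informed-≢O⇒≡C : ∀ {w} → isInformed w ≡ false → w ≢ O → w ≡ C
¬informed-≢O⇒≡C {C} _ _   = refl
¬informed-≢O⇒≡C {O} _ w≢O = ⊥-elim (w≢O refl)

placed-≢O : ∀ a → placed a ≢ O
placed-≢O plus  ()
placed-≢O minus ()

foldr-if-head : ∀ {A B : Set} (b : A → Bool) (f : A → B) {x xs} → x List.∈ xs → b x ≡ true →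
  ∃₂ λ y ys → foldr (λ z acc → if b z then f z ∷ acc else acc) [] xs ≡ f y ∷ ys × b y ≡ true
foldr-if-head b f {xs = y ∷ xs} x∈ bx with b y in by
... | true = y , _ , refl , by
foldr-if-head b f (here refl)  bx | false with () ← trans (sym bx) by
foldr-if-head b f (there x∈xs) bx | false = foldr-if-head b f x∈xs bx

Minimum : (ℕ → Set) → ℕ → Set
Minimum P k = P k × (∀ {m} → P m → k ≤ m)

MinimumOrEmpty : (ℕ → Set) → Set
MinimumOrEmpty P = ∃ (Minimum P) ⊎ (∀ {m} → ¬ P m)

module _ {P Q : ℕ → Set} (to : ∀ {m} → P m → Q m) (from : ∀ {m} → Q m → P m) where

  minimum-map : ∀ {k} → Minimum P k → Minimum Q k
  minimum-map (pk , least) = to pk , least ∘ from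

  minimumOrEmpty-map : MinimumOrEmpty P → MinimumOrEmpty Q
  minimumOrEmpty-map = Sum.map (Product.map₂ minimum-map) (_∘ from)

minimumOrEmpty-⊎ : ∀ {P Q : ℕ → Set} → MinimumOrEmpty P → MinimumOrEmpty Q →
  MinimumOrEmpty (λ m → P m ⊎ Q m)
minimumOrEmpty-⊎ (inj₂ ¬P) (inj₂ ¬Q) = inj₂ [ ¬P , ¬Q ]
minimumOrEmpty-⊎ (inj₁ (k , pk , leastP)) (inj₂ ¬Q) =
  inj₁ (k , inj₁ pk , [ leastP , ⊥-elim ∘ ¬Q ])
minimumOrEmpty-⊎ (inj₂ ¬P) (inj₁ (l , ql , leastQ)) =
  inj₁ (l , inj₂ ql , [ ⊥-elim ∘ ¬P , leastQ ])
minimumOrEmpty-⊎ (inj₁ (k , pk , leastP)) (inj₁ (l , ql , leastQ)) with ≤-total k l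
... | inj₁ k≤l = inj₁ (k , inj₁ pk , [ leastP , ≤-trans k≤l ∘ leastQ ])
... | inj₂ l≤k = inj₁ (l , inj₂ ql , [ ≤-trans l≤k ∘ leastP , leastQ ])

minimumOrEmpty-∃Fin : ∀ {n} {P : Fin n → ℕ → Set} → (∀ i → MinimumOrEmpty (P i)) →
  MinimumOrEmpty (λ m → ∃ λ i → P i m)
minimumOrEmpty-∃Fin {ℕ.zero} _ = inj₂ λ ()
minimumOrEmpty-∃Fin {ℕ.suc n} {P} h =
  minimumOrEmpty-map join split (minimumOrEmpty-⊎ (h zero) (minimumOrEmpty-∃Fin (h ∘ suc)))
  where
  join : ∀ {m} → P zero m ⊎ ∃ (λ i → P (suc i) m) → ∃ (λ i → P i m)
  join = [ (zero ,_) , (λ (i , p) → suc i , p) ]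
  split : ∀ {m} → ∃ (λ i → P i m) → P zero m ⊎ ∃ (λ i → P (suc i) m)
  split (zero  , p) = inj₁ p
  split (suc i , p) = inj₂ (i , p)

minimumOrEmpty-∃Sign : ∀ {P : Sign → ℕ → Set} → (∀ a → MinimumOrEmpty (P a)) →
  MinimumOrEmpty (λ m → ∃ λ a → P a m)
minimumOrEmpty-∃Sign {P} h =
  minimumOrEmpty-map [ (plus ,_) , (minus ,_) ] split (minimumOrEmpty-⊎ (h plus) (h minus))
  where
  split : ∀ {m} → ∃ (λ a → P a m) → P plus m ⊎ P minus m
  split (plus  , p) = inj₁ p
  split (minus , p) = inj₂ p

module _ {n : ℕ} where

  setAt-pointwise : ∀ (R : State → State → Set) {s₁ s₂ : Config n} {v b₁ b₂} x →
    R b₁ b₂ → (x ≢ v → R (s₁ x) (s₂ x)) → R (setAt s₁ v b₁ x) (setAt s₂ v b₂ x)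
  setAt-pointwise R {v = v} x r rₓ with x ≟ v
  ... | yes _   = r
  ... | no x≢v = rₓ x≢v

  setAt-≡O : ∀ {s : Config n} {v b} x → setAt s v b x ≡ O → b ≢ O → x ≢ v × s x ≡ O
  setAt-≡O {v = v} x eq b≢O with x ≟ v
  ... | yes _   = ⊥-elim (b≢O eq)
  ... | no x≢v = x≢v , eq

  SameUpToSigns : Config n → Config n → Set
  SameUpToSigns s₁ s₂ = ∀ x → ∃ λ g → s₂ x ≡ act g (s₁ x)

  module _ {s₁ s₂ : Config n} (signs : SameUpToSigns s₁ s₂) where

    sameUpToSigns-≡O : ∀ x → s₁ x ≡ O → s₂ x ≡ O
    sameUpToSigns-≡O x eq with signs x
    ... | g , eq₂ = trans eq₂ (trans (cong (act g) eq) (act-O g))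

    sameUpToSigns-≡O⁻ : ∀ x → s₂ x ≡ O → s₁ x ≡ O
    sameUpToSigns-≡O⁻ x eq with signs x
    ... | g , eq₂ = act≡O⇒≡O g (trans (sym eq₂) eq)

    sameUpToSigns-≡C : ∀ {x} → s₁ x ≡ C → ∀ q → s₂ x ≡ act q (s₁ x)
    sameUpToSigns-≡C {x} eq q with signs x
    ... | g , eq₂ = begin
      s₂ x          ≡⟨ eq₂ ⟩
      act g (s₁ x)  ≡⟨ cong (act g) eq ⟩
      act g C       ≡⟨ act-C g ⟩
      C             ≡⟨ act-C q ⟨
      act q C       ≡⟨ cong (act q) eq ⟨
      act q (s₁ x)  ∎
      where open ≡-Reasoning

    countC-sameUpToSigns : countC s₂ ≡ countC s₁
    countC-sameUpToSigns = cong sum (map-cong sameIndicator (allFin n))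
      where
      sameIndicator : ∀ x → (if isC (s₂ x) then 1 else 0) ≡ (if isC (s₁ x) then 1 else 0)
      sameIndicator x rewrite proj₂ (signs x) | isC-act (proj₁ (signs x)) (s₁ x) = refl

  uninformed : Config n → Subset n
  uninformed s = tabulate (isZero ∘ s)

  ∈-uninformed⁺ : ∀ {s x} → s x ≡ O → x ∈ uninformed s
  ∈-uninformed⁺ {s} {x} eq =
    lookup⇒[]= x (uninformed s) (trans (lookup∘tabulate (isZero ∘ s) x) (cong isZero eq))

  ∈-uninformed⁻ : ∀ {s x} → x ∈ uninformed s → s x ≡ O
  ∈-uninformed⁻ {s} {x} x∈ =
    isZero⇒≡O (trans (sym (lookup∘tabulate (isZero ∘ s) x)) ([]=⇒lookup x∈))

-- Stated for an arbitrary pair, since negSig (negSig σ) is not definitionally σ.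
Opposite : ∀ {n} {G : Graph n} → Signature G → Signature G → Set
Opposite {n} σ τ = ∀ (u v : Fin n) → sgn τ u v ≡ negS (sgn σ u v)

opposite-negSig : ∀ {n} {G : Graph n} (σ : Signature G) → Opposite σ (negSig σ)
opposite-negSig σ u v = refl

negSig-opposite : ∀ {n} {G : Graph n} (σ : Signature G) → Opposite (negSig σ) σ
negSig-opposite σ u v = sym (negS-involutive (sgn σ u v))

module _ {n : ℕ} (G : Graph n) where

  module _ (σ : Signature G) {s : Config n} where

    update-≡O : ∀ {x} → s x ≡ O → update G σ s x ≡ resolve (received G σ s x)
    update-≡O eq rewrite eq = refl

    update-≢O : ∀ {x} → s x ≢ O → update G σ s x ≡ s x
    update-≢O {x} x≢O with s x
    ... | A    = refl
    ... | negA = refl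
    ... | C    = refl
    ... | O    = ⊥-elim (x≢O refl)

    update≡O⇒≡O : ∀ {x} → update G σ s x ≡ O → s x ≡ O
    update≡O⇒≡O {x} eq with isO? (s x)
    ... | yes x≡O = x≡O
    ... | no  x≢O = ⊥-elim (x≢O (trans (sym (update-≢O x≢O)) eq))

    resolve-received-≢O : ∀ {x z} → adj G x z ≡ true → isInformed (s z) ≡ true →
      resolve (received G σ s x) ≢ O
    resolve-received-≢O {x} {z} xz z-inf
      with foldr-if-head (λ y → adj G x y ∧ isInformed (s y)) (λ y → act (sgn σ x y) (s y))
                         (∈-allFin z) (trans (cong (_∧ isInformed (s z)) xz) z-inf)
    ... | y , ys , heard , y-ok rewrite heard = resolve-∷-≢O {ws = ys} (informed⇒≢O y-inf)
      where
      y-inf : isInformed (act (sgn σ x y) (s y)) ≡ true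
      y-inf = trans (isInformed-act (sgn σ x y) (s y)) (∧-conicalʳ (adj G x y) _ y-ok)

    update≡O⇒¬informed-neighbour : ∀ {x z} → adj G x z ≡ true → update G σ s x ≡ O →
      isInformed (s z) ≡ false
    update≡O⇒¬informed-neighbour {x} {z} xz eq with isInformed (s z) in z-inf
    ... | false = refl
    ... | true  = ⊥-elim (resolve-received-≢O xz z-inf
                           (trans (sym (update-≡O (update≡O⇒≡O eq))) eq))

  record Twisted (p : Sign) (s₁ s₂ : Config n) : Set where
    field
      signs    : SameUpToSigns s₁ s₂
      frontier : ∀ z x → adj G z x ≡ true → s₁ x ≡ O → s₂ z ≡ act p (s₁ z)
  open Twisted

  twisted-allZero : ∀ p → Twisted p allZero allZero
  twisted-allZero p = record
    { signs    = λ _ → plus , refl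
    ; frontier = λ _ _ _ _ → sym (act-O p) }

  twisted-place : ∀ {p s₁ s₂} v a → Twisted p s₁ s₂ →
    Twisted p (setAt s₁ v (placed a)) (setAt s₂ v (placed (p · a)))
  twisted-place {p} v a tw = record
    { signs    = λ x → setAt-pointwise (λ w₁ w₂ → ∃ λ g → w₂ ≡ act g w₁) x
                          (p , placed-· p a) (λ _ → signs tw x)
    ; frontier = λ z x zx x≡O → setAt-pointwise (λ w₁ w₂ → w₂ ≡ act p w₁) z
                          (placed-· p a)
                          (λ _ → frontier tw z x zx (proj₂ (setAt-≡O x x≡O (placed-≢O a)))) }

  update-act-≢O : ∀ σ τ {s₁ s₂ x q} → s₁ x ≢ O → s₂ x ≡ act q (s₁ x) →
    update G τ s₂ x ≡ act q (update G σ s₁ x)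
  update-act-≢O σ τ {s₁} {s₂} {x} {q} x≢O eq = begin
    update G τ s₂ x          ≡⟨ update-≢O τ {s₂} {x} (x≢O ∘ act≡O⇒≡O q ∘ trans (sym eq)) ⟩
    s₂ x                     ≡⟨ eq ⟩
    act q (s₁ x)             ≡⟨ cong (act q) (update-≢O σ {s₁} {x} x≢O) ⟨
    act q (update G σ s₁ x)  ∎
    where open ≡-Reasoning

  module _ {σ τ : Signature G} (opp : Opposite σ τ) where

    received-twisted : ∀ {p s₁ s₂ x} → Twisted p s₁ s₂ → s₁ x ≡ O →
      received G τ s₂ x ≡ map (act (negS p)) (received G σ s₁ x)
    received-twisted {p} {s₁} {s₂} {x} tw x≡O =
      sym (foldr-fusion (map (act (negS p))) [] fuse (allFin n))
      where
      fuse : ∀ z ws →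
        map (act (negS p)) (if adj G x z ∧ isInformed (s₁ z) then act (sgn σ x z) (s₁ z) ∷ ws else ws)
          ≡ (if adj G x z ∧ isInformed (s₂ z)
               then act (sgn τ x z) (s₂ z) ∷ map (act (negS p)) ws
               else map (act (negS p)) ws)
      fuse z ws with adj G x z in xz
      ... | false = refl
      ... | true rewrite frontier tw z x (trans (Graph.sym G z x) xz) x≡O
                       | isInformed-act p (s₁ z)
                       | opp x z
                  with isInformed (s₁ z)
      ...   | false = refl
      ...   | true  = cong (_∷ _) (sym (act-negS-swap (sgn σ x z) p (s₁ z)))

    update-twisted : ∀ {p s₁ s₂ x} → Twisted p s₁ s₂ → s₁ x ≡ O →
      update G τ s₂ x ≡ act (negS p) (update G σ s₁ x)
    update-twisted {p} {s₁} {s₂} {x} tw x≡O = begin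
      update G τ s₂ x                                   ≡⟨ update-≡O τ (sameUpToSigns-≡O (signs tw) x x≡O) ⟩
      resolve (received G τ s₂ x)                       ≡⟨ cong resolve (received-twisted tw x≡O) ⟩
      resolve (map (act (negS p)) (received G σ s₁ x))  ≡⟨ resolve-act (negS p) (received G σ s₁ x) ⟩
      act (negS p) (resolve (received G σ s₁ x))        ≡⟨ cong (act (negS p)) (update-≡O σ x≡O) ⟨
      act (negS p) (update G σ s₁ x)                    ∎
      where open ≡-Reasoning

    twisted-update : ∀ {p s₁ s₂} → Twisted p s₁ s₂ → Twisted (negS p) (update G σ s₁) (update G τ s₂)
    twisted-update {p} {s₁} {s₂} tw = record { signs = signs′ ; frontier = frontier′ }
      where
      signs′ : SameUpToSigns (update G σ s₁) (update G τ s₂)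
      signs′ x with isO? (s₁ x)
      ... | yes x≡O = negS p , update-twisted tw x≡O
      ... | no  x≢O = Product.map₂ (update-act-≢O σ τ {s₁} {s₂} x≢O) (signs tw x)

      frontier′ : ∀ z x → adj G z x ≡ true → update G σ s₁ x ≡ O →
        update G τ s₂ z ≡ act (negS p) (update G σ s₁ z)
      frontier′ z x zx eq with isO? (s₁ z)
      ... | yes z≡O = update-twisted tw z≡O
      -- z is not informed, for x would have heard from it; being non-O it is C, which no sign moves.
      ... | no  z≢O = update-act-≢O σ τ {s₁} {s₂} z≢O (sameUpToSigns-≡C (signs tw) z≡C (negS p))
        where
        z≡C : s₁ z ≡ C
        z≡C = ¬informed-≢O⇒≡C
                (update≡O⇒¬informed-neighbour σ {s₁} (trans (Graph.sym G x z) zx) eq) z≢O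

    simulate : ∀ {p s₁ s₂ k} → Twisted p s₁ s₂ → Run G σ s₁ k → Run G τ s₂ k
    simulate tw (done s₁-full) =
      subst (Run G τ _) (countC-sameUpToSigns (signs tw))
        (done λ v → s₁-full v ∘ sameUpToSigns-≡O⁻ (signs tw) v)
    simulate {p} tw (step v v≡O a run) =
      step v (sameUpToSigns-≡O (signs tw) v v≡O) (p · a)
        (simulate (twisted-update (twisted-place v a tw)) run)

    run-opposite : ∀ {k} → Run G σ allZero k → Run G τ allZero k
    run-opposite = simulate (twisted-allZero plus)

  module _ (σ : Signature G) where

    stepConfig-⊂ : ∀ {s v} a → s v ≡ O → uninformed (stepConfig G σ s v a) ⊂ uninformed s
    stepConfig-⊂ {s} {v} a v≡O = (∈-uninformed⁺ ∘ proj₂ ∘ stillUninformed) , v , ∈-uninformed⁺ v≡O ,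
                           (λ v∈ → proj₁ (stillUninformed v∈) refl)
      where
      stillUninformed : ∀ {x} → x ∈ uninformed (stepConfig G σ s v a) → x ≢ v × s x ≡ O
      stillUninformed {x} x∈ =
        setAt-≡O {s = s} x (update≡O⇒≡O σ {setAt s v (placed a)} {x} (∈-uninformed⁻ x∈)) (placed-≢O a)

    Moves : Config n → ℕ → Set
    Moves s m = ∃ λ v → s v ≡ O × ∃ λ a → Run G σ (stepConfig G σ s v a) m

    MinimumAfterMoves : Config n → Set
    MinimumAfterMoves s = ∀ {v} a → s v ≡ O → ∃ (Minimum (Run G σ (stepConfig G σ s v a)))

    minimumOrEmpty-moves : ∀ s → MinimumAfterMoves s → MinimumOrEmpty (Moves s)
    minimumOrEmpty-moves s minimumAfter = minimumOrEmpty-∃Fin movesAt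
      where
      movesAt : ∀ v → MinimumOrEmpty (λ m → s v ≡ O × ∃ λ a → Run G σ (stepConfig G σ s v a) m)
      movesAt v with isO? (s v)
      ... | no  v≢O = inj₂ (v≢O ∘ proj₁)
      ... | yes v≡O = minimumOrEmpty-map (v≡O ,_) proj₂
                        (minimumOrEmpty-∃Sign λ a → inj₁ (minimumAfter a v≡O))

    minimum-done : ∀ {s} → (∀ v → s v ≢ O) → Minimum (Run G σ s) (countC s)
    minimum-done full = done full , least
      where
      least : ∀ {m} → Run G σ _ m → _ ≤ m
      least (done _)         = ≤-refl
      least (step v v≡O _ _) = ⊥-elim (full v v≡O)

    minimum-step : ∀ {s w} → s w ≡ O → MinimumAfterMoves s → ∃ (Minimum (Run G σ s))
    minimum-step {s} {w} w≡O minimumAfter with minimumOrEmpty-moves s minimumAfter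
    ... | inj₁ (k , least) = k , minimum-map moved unmoved least
      where
      moved : ∀ {m} → Moves s m → Run G σ s m
      moved (v , v≡O , a , run) = step v v≡O a run
      unmoved : ∀ {m} → Run G σ s m → Moves s m
      unmoved (done full)        = ⊥-elim (full w w≡O)
      unmoved (step v v≡O a run) = v , v≡O , a , run
    ... | inj₂ none = ⊥-elim (none (w , w≡O , plus , proj₁ (proj₂ (minimumAfter plus w≡O))))

    minimumRun : ∀ s → Acc (_⊂_ on uninformed) s → ∃ (Minimum (Run G σ s))
    minimumRun s (acc rec) with any? (isO? ∘ s)
    ... | no  full      = countC s , minimum-done λ v v≡O → full (v , v≡O)
    ... | yes (w , w≡O) = minimum-step w≡O λ a v≡O → minimumRun _ (rec (stepConfig-⊂ a v≡O))

theorem3p4 : ∀ {n : ℕ} (G : Graph n) (σ : Signature G) →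
    Σ ℕ (λ k → IsCr G σ k × IsCr G (negSig σ) k)
theorem3p4 G σ with minimumRun G σ allZero (On.wellFounded uninformed ⊂-wellFounded allZero)
... | k , minimal = k , minimal ,
      minimum-map (run-opposite G (opposite-negSig σ)) (run-opposite G (negSig-opposite σ)) minimal
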